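{- Let $R$ be a diagonal rectangulation. A flip of an interior edge $e$ of $R$ is a Law-Reading flip (i.e. $e$ is Law-Reading flippable) if and only if either $e$ is simply flippable (unmatched at both endpoints), or $e$ is a flippable edge, matched at exactly one endpoint, that does not intersect the main diagonal, flipped by rotation.
   Context: A rectangulation is a partition of the unit square $S=[0,1]^2$ into finitely many axis-parallel rectangles with disjoint interiors such that every vertex other than the four corners of $S$ has exactly three incident edges. Vertex types are $\vdash,\dashv,\top,\bot$. An edge is a piece of a rectangle side between two vertices with no vertex in its interior; a segment is a maximal straight line segment that is a union of edges. Rectangulations are considered up to combinatorial equivalence, i.e. deformations preserving the order of vertices along every segment. The main diagonal of $S$ runs from $(0,1)$ to $(1,0)$. A diagonal rectangulation is one having a representative in which every rectangle meets the main diagonal. We always draw it in such a representative with the diagonal avoiding vertices; "intersects the diagonal" refers to such a drawing. Flips. Let $e$ be an edge not on the boundary of $S$. The edge $e$ is matched at an endpoint $p$ if $p$ is incident to another edge collinear with $e$. (i) Simple flip: if $e$ is unmatched at both endpoints, the two rectangles separated by $e$ form a rectangle. Replace $e$ by an edge of the other orientation splitting this union into two rectangles, placed so the result is again a diagonal rectangulation. Such $e$ is called simply flippable. (ii) Rotation: suppose $e$ is matched at exactly one endpoint $p$. Besides $e$ and its collinear continuation, $p$ has a third, perpendicular edge $f$. Rotating $e$ about $p$ means deleting $e$ and adding a new edge at $p$, collinear with $f$ on the opposite side of $p$, extending until it meets the next segment. If the resulting rectangulation is a diagonal rectangulation, $e$ is flippable and this rotation is a flip; otherwise $e$ is unflippable.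 Edges matched at both endpoints are unflippable. A flip of $e$ is either (i) or (ii). Law-Reading flippable edges. In a diagonal rectangulation, every interior vertex $v$ lies strictly above or below the main diagonal. The edges at $v$ pointing toward the diagonal are the leftward and downward ones if $v$ is above, and the rightward and upward ones if $v$ is below. There are exactly two such edges, exactly one of which is matched at $v$; that edge is excluded (locked) at $v$. An interior edge is Law-Reading flippable if it is not locked at any of its endpoints. A Law-Reading flip is the flip of a Law-Reading flippable edge. -}

module Defs where

-- Concrete (integer-coordinate) drawings of rectangulations of the square
-- [0,N]^2 (the unit square scaled by N), with y pointing up.  The main
-- diagonal from (0,1) to (1,0) becomes the line x + y = N.

open import Data.Nat using (ℕ; zero; suc; _+_; _≤_; _<_; _⊓_; _⊔_)
open import Data.Fin using (Fin)
open import Data.Product using (Σ; ∃; _×_; _,_)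
open import Data.Sum using (_⊎_)
open import Relation.Nullary using (¬_)
open import Relation.Binary.PropositionalEquality using (_≡_; _≢_)
open import Function.Bundles using (_⇔_; _↔_; Inverse)

record Rect : Set where
  constructor mkRect
  field
    x₁ x₂ y₁ y₂ : ℕ

open Rect public

record Drawing (n : ℕ) : Set where
  constructor drawing
  field
    N    : ℕ
    rect : Fin n → Rect

open Drawing public

Corner : Rect → ℕ → ℕ → Set
Corner r a b = (a ≡ x₁ r ⊎ a ≡ x₂ r) × (b ≡ y₁ r ⊎ b ≡ y₂ r)

Vertex : ∀ {n} → Drawing n → ℕ → ℕ → Set
Vertex D a b = ∃ λ i → Corner (rect D i) a b

OnSideInterior : Rect → ℕ → ℕ → Set
OnSideInterior r a b =
  ((a ≡ x₁ r ⊎ a ≡ x₂ r) × y₁ r < b × b < y₂ r)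
  ⊎ ((b ≡ y₁ r ⊎ b ≡ y₂ r) × x₁ r < a × a < x₂ r)

-- A rectangulation of [0,N]^2: nondegenerate rectangles inside the square,
-- pairwise disjoint interiors, covering the square (every unit cell is
-- covered), and every vertex which is not a corner of the square has degree
-- exactly 3.  (For an interior point that is a corner of some rectangle the
-- degree is 3 iff it lies in the relative interior of a side of another
-- rectangle, and 4 otherwise; boundary vertices always have degree 3.)
IsRectangulation : ∀ {n} → Drawing n → Set
IsRectangulation {n} D =
  (0 < N D)
  × (∀ i → x₁ (rect D i) < x₂ (rect D i) × y₁ (rect D i) < y₂ (rect D i)
           × x₂ (rect D i) ≤ N D × y₂ (rect D i) ≤ N D)
  × (∀ i j → i ≢ j →
       x₂ (rect D i) ≤ x₁ (rect D j) ⊎ x₂ (rect D j) ≤ x₁ (rect D i)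
       ⊎ y₂ (rect D i) ≤ y₁ (rect D j) ⊎ y₂ (rect D j) ≤ y₁ (rect D i))
  × (∀ a b → a < N D → b < N D → ∃ λ i →
       x₁ (rect D i) ≤ a × a < x₂ (rect D i) × y₁ (rect D i) ≤ b × b < y₂ (rect D i))
  × (∀ a b → 0 < a → a < N D → 0 < b → b < N D → Vertex D a b →
       ∃ λ i → OnSideInterior (rect D i) a b)

MeetsDiag : ℕ → Rect → Set
MeetsDiag N r = x₁ r + y₁ r ≤ N × N ≤ x₂ r + y₂ r

OffDiag : ℕ → ℕ → ℕ → Set
OffDiag N a b = (a + b ≢ N) ⊎ (a ≡ 0 × b ≡ N) ⊎ (a ≡ N × b ≡ 0)

DiagonalDrawing : ∀ {n} → Drawing n → Set
DiagonalDrawing {n} D =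
  IsRectangulation D
  × (∀ i → MeetsDiag (N D) (rect D i))
  × (∀ a b → Vertex D a b → OffDiag (N D) a b)

LeftOf : ∀ {n} → Drawing n → Fin n → Fin n → Set
LeftOf D i j = x₂ (rect D i) ≡ x₁ (rect D j)
             × y₁ (rect D i) < y₂ (rect D j) × y₁ (rect D j) < y₂ (rect D i)

BelowOf : ∀ {n} → Drawing n → Fin n → Fin n → Set
BelowOf D i j = y₂ (rect D i) ≡ y₁ (rect D j)
              × x₁ (rect D i) < x₂ (rect D j) × x₁ (rect D j) < x₂ (rect D i)

-- Combinatorial equivalence of rectangulations: a bijection of rectangles
-- preserving and reflecting the left/below contact relations (this records
-- exactly the order of the vertices along every segment).
_≅_ : ∀ {n} → Drawing n → Drawing n → Set
_≅_ {n} D D' = Σ (Fin n ↔ Fin n) λ σ →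
  (∀ i j → LeftOf D i j ⇔ LeftOf D' (Inverse.to σ i) (Inverse.to σ j))
  × (∀ i j → BelowOf D i j ⇔ BelowOf D' (Inverse.to σ i) (Inverse.to σ j))

IsDiagonalRectangulation : ∀ {n} → Drawing n → Set
IsDiagonalRectangulation {n} D =
  IsRectangulation D × ∃ λ (D' : Drawing n) → DiagonalDrawing D' × (D' ≅ D)

-- hor y x x' : the horizontal piece [x,x'] × {y};
-- ver x y y' : the vertical piece {x} × [y,y'].
data Edge : Set where
  hor : ℕ → ℕ → ℕ → Edge
  ver : ℕ → ℕ → ℕ → Edge

IsEdge : ∀ {n} → Drawing n → Edge → Set
IsEdge D (hor y x x') =
  x < x' × Vertex D x y × Vertex D x' y
  × (∀ c → x < c → c < x' → ¬ Vertex D c y)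
  × (∃ λ i → (y ≡ y₁ (rect D i) ⊎ y ≡ y₂ (rect D i))
             × x₁ (rect D i) ≤ x × x' ≤ x₂ (rect D i))
IsEdge D (ver x y y') =
  y < y' × Vertex D x y × Vertex D x y'
  × (∀ c → y < c → c < y' → ¬ Vertex D x c)
  × (∃ λ i → (x ≡ x₁ (rect D i) ⊎ x ≡ x₂ (rect D i))
             × y₁ (rect D i) ≤ y × y' ≤ y₂ (rect D i))

IsInteriorEdge : ∀ {n} → Drawing n → Edge → Set
IsInteriorEdge D e@(hor y x x') = IsEdge D e × 0 < y × y < N D
IsInteriorEdge D e@(ver x y y') = IsEdge D e × 0 < x × x < N D

-- the two endpoints of an edge: lo = left/bottom, hi = right/top
data End : Set where
  lo hi : End

opp : End → End
opp lo = hi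
opp hi = lo

endX endY : Edge → End → ℕ
endX (hor y x x') lo = x
endX (hor y x x') hi = x'
endX (ver x y y') _  = x
endY (hor y x x') _  = y
endY (ver x y y') lo = y
endY (ver x y y') hi = y'

-- e is matched at the endpoint p: p is incident to another edge collinear
-- with e (necessarily continuing e beyond p)
MatchedAt : ∀ {n} → Drawing n → Edge → End → Set
MatchedAt D (hor y x x') lo = ∃ λ c → IsEdge D (hor y c x)
MatchedAt D (hor y x x') hi = ∃ λ c → IsEdge D (hor y x' c)
MatchedAt D (ver x y y') lo = ∃ λ c → IsEdge D (ver x c y)
MatchedAt D (ver x y y') hi = ∃ λ c → IsEdge D (ver x y' c)

SimplyFlippable : ∀ {n} → Drawing n → Edge → Set
SimplyFlippable D e = ¬ MatchedAt D e lo × ¬ MatchedAt D e hi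

data Dir : Set where
  leftward rightward downward upward : Dir

dirAt : Edge → End → Dir
dirAt (hor _ _ _) lo = rightward
dirAt (hor _ _ _) hi = leftward
dirAt (ver _ _ _) lo = upward
dirAt (ver _ _ _) hi = downward

PointsTowardDiag : ℕ → Edge → End → Set
PointsTowardDiag N e p =
  (N < endX e p + endY e p × (dirAt e p ≡ leftward ⊎ dirAt e p ≡ downward))
  ⊎ (endX e p + endY e p < N × (dirAt e p ≡ rightward ⊎ dirAt e p ≡ upward))

InteriorPoint : ℕ → ℕ → ℕ → Set
InteriorPoint N a b = 0 < a × a < N × 0 < b × b < N

-- e is locked (excluded) at its endpoint p: p is an interior vertex, e is
-- one of the two edges at p pointing toward the diagonal, and it is the one
-- matched at p
LockedAt : ∀ {n} → Drawing n → Edge → End → Set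
LockedAt D e p = InteriorPoint (N D) (endX e p) (endY e p)
               × PointsTowardDiag (N D) e p × MatchedAt D e p

LawReadingFlippable : ∀ {n} → Drawing n → Edge → Set
LawReadingFlippable D e =
  IsInteriorEdge D e × ¬ LockedAt D e lo × ¬ LockedAt D e hi

IntersectsDiag : ℕ → Edge → Set
IntersectsDiag N (hor y x x') = x + y ≤ N × N ≤ x' + y
IntersectsDiag N (ver x y y') = x + y ≤ N × N ≤ x + y'

Separates : ∀ {n} → Drawing n → Edge → Fin n → Fin n → Set
Separates D (hor y x x') i j =
  ((y₂ (rect D i) ≡ y × y₁ (rect D j) ≡ y) ⊎ (y₁ (rect D i) ≡ y × y₂ (rect D j) ≡ y))
  × x₁ (rect D i) ≤ x × x' ≤ x₂ (rect D i)
  × x₁ (rect D j) ≤ x × x' ≤ x₂ (rect D j)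
Separates D (ver x y y') i j =
  ((x₂ (rect D i) ≡ x × x₁ (rect D j) ≡ x) ⊎ (x₁ (rect D i) ≡ x × x₂ (rect D j) ≡ x))
  × y₁ (rect D i) ≤ y × y' ≤ y₂ (rect D i)
  × y₁ (rect D j) ≤ y × y' ≤ y₂ (rect D j)

-- X = rect i has a corner at p (so the perpendicular edge f at p lies along
-- a side of X), Y = rect j extends beyond p (its side carries e and the
-- collinear continuation of e).  Rotating e about p deletes e and extends
-- the line of f across Y up to the opposite side of Y: X together with the
-- near part of Y becomes one rectangle (stored at index i), the far part of
-- Y becomes the other (stored at index j); every other rectangle is unchanged.
RotStep : ∀ {n} → Drawing n → Edge → End → Fin n → Fin n → Rect → Rect → Set
RotStep D (hor y x x') lo i j Mi Fj =
  x₁ (rect D i) ≡ x × x₁ (rect D j) < x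
  × Mi ≡ mkRect x x' (y₁ (rect D i) ⊓ y₁ (rect D j)) (y₂ (rect D i) ⊔ y₂ (rect D j))
  × Fj ≡ mkRect (x₁ (rect D j)) x (y₁ (rect D j)) (y₂ (rect D j))
RotStep D (hor y x x') hi i j Mi Fj =
  x₂ (rect D i) ≡ x' × x' < x₂ (rect D j)
  × Mi ≡ mkRect x x' (y₁ (rect D i) ⊓ y₁ (rect D j)) (y₂ (rect D i) ⊔ y₂ (rect D j))
  × Fj ≡ mkRect x' (x₂ (rect D j)) (y₁ (rect D j)) (y₂ (rect D j))
RotStep D (ver x y y') lo i j Mi Fj =
  y₁ (rect D i) ≡ y × y₁ (rect D j) < y
  × Mi ≡ mkRect (x₁ (rect D i) ⊓ x₁ (rect D j)) (x₂ (rect D i) ⊔ x₂ (rect D j)) y y'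
  × Fj ≡ mkRect (x₁ (rect D j)) (x₂ (rect D j)) (y₁ (rect D j)) y
RotStep D (ver x y y') hi i j Mi Fj =
  y₂ (rect D i) ≡ y' × y' < y₂ (rect D j)
  × Mi ≡ mkRect (x₁ (rect D i) ⊓ x₁ (rect D j)) (x₂ (rect D i) ⊔ x₂ (rect D j)) y y'
  × Fj ≡ mkRect (x₁ (rect D j)) (x₂ (rect D j)) y' (y₂ (rect D j))

RotatedAbout : ∀ {n} → Drawing n → Edge → End → Drawing n → Set
RotatedAbout D e p D' =
  N D' ≡ N D
  × Σ _ λ i → Σ _ λ j → i ≢ j × Separates D e i j
    × RotStep D e p i j (rect D' i) (rect D' j)
    × (∀ k → k ≢ i → k ≢ j → rect D' k ≡ rect D k)

FlippableByRotation : ∀ {n} → Drawing n → Edge → Set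
FlippableByRotation {n} D e =
  Σ End λ p → MatchedAt D e p × ¬ MatchedAt D e (opp p)
    × Σ (Drawing n) λ D' → RotatedAbout D e p D' × IsDiagonalRectangulation D'

{-# OPTIONS --safe #-}

-- By transposition it suffices to treat a horizontal edge e.  A lock can
-- only occur at an endpoint from which e points toward the diagonal, and
-- there it means that e is matched.  If e crosses the diagonal, both
-- endpoints point toward it, so e is Law–Reading flippable iff it is simply
-- flippable.  If e lies above the diagonal, only its right end points toward
-- it, and its left end is always matched: the rectangle above e meets the
-- diagonal, so it reaches further left.  Hence e is Law–Reading flippable iff
-- it is unmatched on the right, and in that case rotating e about its left
-- end gives again a diagonal drawing: the rectangle below e grows up to the
-- top of the one above, whose remaining part lies left of the new edge.  The
-- only new vertex lies above the diagonal, where it is automatically inside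
-- the bottom side of the rectangle on top.  Below the diagonal the picture is
-- point-reflected.
module Submission where

open import Defs
open import Data.Nat using (ℕ)
open import Data.Sum using (_⊎_)
open import Data.Product using (_×_)
open import Relation.Nullary using (¬_)
open import Function.Bundles using (_⇔_)

open import Data.Nat using (zero; suc; _+_; _≤_; _<_; _⊔_; z≤n; s≤s; _≟_; _<?_)
open import Data.Nat.Properties
open import Data.Fin using (Fin) renaming (_≟_ to _≟ᶠ_)
open import Data.Fin.Properties using (any?)
open import Data.Vec.Functional using (updateAt)
open import Data.Vec.Functional.Properties using (updateAt-updates; updateAt-minimal)
open import Data.Product using (∃; ∃₂; _,_; proj₁; proj₂)
open import Data.Sum using (inj₁; inj₂)
open import Data.Empty using (⊥; ⊥-elim)
open import Relation.Nullary using (Dec; yes; no; contradiction)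
open import Relation.Nullary.Decidable using (_×-dec_; _⊎-dec_)
open import Relation.Binary.Definitions using (tri<; tri≈; tri>)
open import Relation.Binary.PropositionalEquality
  using (_≡_; _≢_; refl; sym; trans; cong; cong₂; subst; subst₂)
open import Function.Bundles using (mk⇔; Equivalence)
open import Function.Construct.Identity using (↔-id)
open import Function.Base using (_∘_; id)

-- r contains the unit cell with lower-left corner (a , b).
Covers : Rect → ℕ → ℕ → Set
Covers r a b = x₁ r ≤ a × a < x₂ r × y₁ r ≤ b × b < y₂ r

Separated : Rect → Rect → Set
Separated r s = x₂ r ≤ x₁ s ⊎ x₂ s ≤ x₁ r ⊎ y₂ r ≤ y₁ s ⊎ y₂ s ≤ y₁ r

WithinSquare : ℕ → Rect → Set
WithinSquare N r = x₁ r < x₂ r × y₁ r < y₂ r × x₂ r ≤ N × y₂ r ≤ N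

rect-≡ : ∀ {r a b c d} → x₁ r ≡ a → x₂ r ≡ b → y₁ r ≡ c → y₂ r ≡ d → r ≡ mkRect a b c d
rect-≡ refl refl refl refl = refl

interval-end : ∀ {l h a} → l < h → a ≡ l ⊎ a ≡ h →
  ∃ λ c → (l ≤ c × c < h) × (c ≡ a ⊎ suc c ≡ a)
interval-end l<h        (inj₁ refl) = _ , (≤-refl , l<h) , inj₁ refl
interval-end (s≤s l≤h₀) (inj₂ refl) = _ , (l≤h₀ , ≤-refl) , inj₂ refl

separated⇒no-common-cell : ∀ {r s a b} → Separated r s → Covers r a b → Covers s a b → ⊥
separated⇒no-common-cell (inj₁ h)               (_ , ar , _)     (as , _)         = <⇒≱ ar (≤-trans h as)
separated⇒no-common-cell (inj₂ (inj₁ h))        (ar , _)         (_ , as , _)     = <⇒≱ as (≤-trans h ar)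
separated⇒no-common-cell (inj₂ (inj₂ (inj₁ h))) (_ , _ , _ , br) (_ , _ , bs , _) = <⇒≱ br (≤-trans h bs)
separated⇒no-common-cell (inj₂ (inj₂ (inj₂ h))) (_ , _ , br , _) (_ , _ , _ , bs) = <⇒≱ bs (≤-trans h br)

no-common-cell⇒separated : ∀ {N r s} → WithinSquare N r → WithinSquare N s →
  (∀ a b → Covers r a b → Covers s a b → ⊥) → Separated r s
no-common-cell⇒separated {r = r} {s} (xr , yr , _) (xs , ys , _) disjoint
  with x₂ r ≤? x₁ s | x₂ s ≤? x₁ r | y₂ r ≤? y₁ s | y₂ s ≤? y₁ r
... | yes h | _     | _     | _     = inj₁ h
... | no _  | yes h | _     | _     = inj₂ (inj₁ h)
... | no _  | no _  | yes h | _     = inj₂ (inj₂ (inj₁ h))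
... | no _  | no _  | no _  | yes h = inj₂ (inj₂ (inj₂ h))
... | no p  | no q  | no u  | no v  = ⊥-elim (disjoint a b
      (m≤m⊔n _ _ , ⊔-lub xr (≰⇒> p) , m≤m⊔n _ _ , ⊔-lub yr (≰⇒> u))
      (m≤n⊔m _ _ , ⊔-lub (≰⇒> q) xs , m≤n⊔m _ _ , ⊔-lub (≰⇒> v) ys))
  where
  a b : ℕ
  a = x₁ r ⊔ x₁ s
  b = y₁ r ⊔ y₁ s

module Rectangulation {n} {D : Drawing n} (isR : IsRectangulation D) where

  within-square : ∀ i → WithinSquare (N D) (rect D i)
  within-square = proj₁ (proj₂ isR)

  y₁<y₂ : ∀ i → y₁ (rect D i) < y₂ (rect D i)
  y₁<y₂ i = proj₁ (proj₂ (within-square i))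

  x₂≤N : ∀ i → x₂ (rect D i) ≤ N D
  x₂≤N i = proj₁ (proj₂ (proj₂ (within-square i)))

  separated : ∀ i j → i ≢ j → Separated (rect D i) (rect D j)
  separated = proj₁ (proj₂ (proj₂ isR))

  covered : ∀ a b → a < N D → b < N D → ∃ λ i → Covers (rect D i) a b
  covered = proj₁ (proj₂ (proj₂ (proj₂ isR)))

  degree-three : ∀ a b → InteriorPoint (N D) a b → Vertex D a b →
    ∃ λ i → OnSideInterior (rect D i) a b
  degree-three a b (a>0 , a<N , b>0 , b<N) =
    proj₂ (proj₂ (proj₂ (proj₂ isR))) a b a>0 a<N b>0 b<N

  covers-unique : ∀ {i j a b} → Covers (rect D i) a b → Covers (rect D j) a b → i ≡ j
  covers-unique {i} {j} ci cj with i ≟ᶠ j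
  ... | yes i≡j = i≡j
  ... | no  i≢j = ⊥-elim (separated⇒no-common-cell (separated i j i≢j) ci cj)

  corner-covers : ∀ {i a b} → Corner (rect D i) a b →
    ∃₂ λ c d → Covers (rect D i) c d × (c ≡ a ⊎ suc c ≡ a) × (d ≡ b ⊎ suc d ≡ b)
  corner-covers {i} (ca , cb) with within-square i
  ... | xi , yi , _ with interval-end xi ca | interval-end yi cb
  ...   | c , (c₁ , c₂) , c≈a | d , (d₁ , d₂) , d≈b =
    c , d , (c₁ , c₂ , d₁ , d₂) , c≈a , d≈b

  -- A rectangle with a corner at (suc p , suc q) covers one of the four
  -- cells around it, so it is U or L; but neither has a vertical side there.
  straddled-not-vertex : ∀ {p q U L} →
    Covers (rect D U) p (suc q) → Covers (rect D U) (suc p) (suc q) →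
    Covers (rect D L) p q → Covers (rect D L) (suc p) q → ¬ Vertex D (suc p) (suc q)
  straddled-not-vertex {p} {q} {U} {L} U₀ U₁ L₀ L₁ (k , corner) with corner-covers corner
  ... | c , d , ck , c≈ , d≈ = no-vertical-side (touching c≈ d≈ ck) (proj₁ corner)
    where
    touching : ∀ {c d} → c ≡ suc p ⊎ suc c ≡ suc p → d ≡ suc q ⊎ suc d ≡ suc q →
      Covers (rect D k) c d → k ≡ U ⊎ k ≡ L
    touching (inj₁ refl) (inj₁ refl) ck = inj₁ (covers-unique ck U₁)
    touching (inj₂ refl) (inj₁ refl) ck = inj₁ (covers-unique ck U₀)
    touching (inj₁ refl) (inj₂ refl) ck = inj₂ (covers-unique ck L₁)
    touching (inj₂ refl) (inj₂ refl) ck = inj₂ (covers-unique ck L₀)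
    between : ∀ {r b b'} → Covers r p b → Covers r (suc p) b' →
      ¬ (suc p ≡ x₁ r ⊎ suc p ≡ x₂ r)
    between (left , _) _ (inj₁ eq) = <⇒≱ ≤-refl (subst (_≤ p) (sym eq) left)
    between _ (_ , right , _) (inj₂ eq) = <-irrefl eq right
    no-vertical-side : k ≡ U ⊎ k ≡ L → ¬ (suc p ≡ x₁ (rect D k) ⊎ suc p ≡ x₂ (rect D k))
    no-vertical-side (inj₁ refl) = between U₀ U₁
    no-vertical-side (inj₂ refl) = between L₀ L₁

  extends-left-not-vertex : ∀ {c q U L} → Covers (rect D U) c (suc q) → Covers (rect D L) c q →
    x₁ (rect D U) < c → x₁ (rect D L) < c → ¬ Vertex D c (suc q)
  extends-left-not-vertex {suc p} cU@(_ , U> , U-rows) cL@(_ , L> , L-rows) (s≤s U≤p) (s≤s L≤p) =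
    straddled-not-vertex (U≤p , <-trans (n<1+n p) U> , U-rows) cU
                         (L≤p , <-trans (n<1+n p) L> , L-rows) cL

  extends-right-not-vertex : ∀ {p q U L} → Covers (rect D U) p (suc q) → Covers (rect D L) p q →
    suc p < x₂ (rect D U) → suc p < x₂ (rect D L) → ¬ Vertex D (suc p) (suc q)
  extends-right-not-vertex {p} cU@(U≤p , _ , U-rows) cL@(L≤p , _ , L-rows) U> L> =
    straddled-not-vertex cU (≤-trans U≤p (n≤1+n p) , U> , U-rows)
                         cL (≤-trans L≤p (n≤1+n p) , L> , L-rows)

module Diagonal {n} {D : Drawing n} (diag : DiagonalDrawing D) where

  rectangulation : IsRectangulation D
  rectangulation = proj₁ diag

  open Rectangulation rectangulation public

  meets-diagonal : ∀ i → MeetsDiag (N D) (rect D i)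
  meets-diagonal = proj₁ (proj₂ diag)

  off-diagonal : ∀ a b → Vertex D a b → OffDiag (N D) a b
  off-diagonal = proj₂ (proj₂ diag)

  -- Above the diagonal, the rectangle V on top of k cannot have its lower-left
  -- corner at (c , b), so that point lies inside V's bottom side; below the
  -- diagonal, symmetrically, the rectangle under k cannot have its upper-right
  -- corner there.
  top-side-point-above-diagonal : ∀ {k c b} → x₁ (rect D k) ≤ c → c < x₂ (rect D k) →
    y₂ (rect D k) ≡ b → b < N D → N D < c + b →
    ∃ λ V → b ≡ y₁ (rect D V) × x₁ (rect D V) < c × c < x₂ (rect D V)
  top-side-point-above-diagonal {k} {c} left right top b<N above
    with subst (y₁ (rect D k) <_) top (y₁<y₂ k)
  ... | s≤s {n = d} y₁≤d
    with covered c (suc d) (<-≤-trans right (x₂≤N k)) b<N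
  ...   | V , (left′ , right′ , bottom , d<top) =
    V , sym bottom≡ , ≤∧≢⇒< left′ corner-off , right′
    where
    bottom≡ : y₁ (rect D V) ≡ suc d
    bottom≡ with m≤n⇒m<n∨m≡n bottom
    ... | inj₂ eq = eq
    ... | inj₁ (s≤s below)
      with covers-unique {i = k} (left , right , y₁≤d , ≤-reflexive (sym top))
                                 (left′ , right′ , below , ≤-trans (n≤1+n _) d<top)
    ...   | refl = contradiction d<top (<-irrefl (sym top))
    corner-off : x₁ (rect D V) ≢ c
    corner-off eq = <⇒≱ above
      (subst₂ (λ u w → u + w ≤ N D) eq bottom≡ (proj₁ (meets-diagonal V)))

  bottom-side-point-below-diagonal : ∀ {k c b} → x₁ (rect D k) < c → c < x₂ (rect D k) →
    y₁ (rect D k) ≡ b → 0 < b → c + b < N D →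
    ∃ λ V → b ≡ y₂ (rect D V) × x₁ (rect D V) < c × c < x₂ (rect D V)
  bottom-side-point-below-diagonal {k} {suc c} {suc d} (s≤s left) right bottom (s≤s z≤n) below
    with covered c d (<-trans (n<1+n c) (<-≤-trans right (x₂≤N k)))
                     (<⇒≤ (≤-<-trans (m≤n+m (suc d) (suc c)) below))
  ... | V , (left′ , right′ , y₁≤d , d<top) =
    V , sym top≡ , s≤s left′ , ≤∧≢⇒< right′ corner-off
    where
    top≡ : y₂ (rect D V) ≡ suc d
    top≡ with m≤n⇒m<n∨m≡n d<top
    ... | inj₂ eq = sym eq
    ... | inj₁ above
      with covers-unique {i = k}
             (left , <-trans (n<1+n c) right , ≤-reflexive bottom ,
              subst (_< y₂ (rect D k)) bottom (y₁<y₂ k))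
             (left′ , right′ , ≤-trans y₁≤d (n≤1+n d) , above)
    ...   | refl = contradiction (subst (_≤ d) bottom y₁≤d) (<⇒≱ ≤-refl)
    corner-off : suc c ≢ x₂ (rect D V)
    corner-off eq = <⇒≱ below
      (subst₂ (λ u w → N D ≤ u + w) (sym eq) top≡ (proj₂ (meets-diagonal V)))

module _ {P : ℕ → Set} (P? : ∀ c → Dec (P c)) where

  nearest-below : ∀ {m} x → m < x → P m →
    ∃ λ c → m ≤ c × c < x × P c × (∀ d → c < d → d < x → ¬ P d)
  nearest-below {m} (suc x) (s≤s m≤x) Pm with P? x
  ... | yes Px = x , m≤x , ≤-refl , Px , λ d x<d d≤x _ → <⇒≱ x<d (≤-pred d≤x)
  ... | no ¬Px with nearest-below x (≤∧≢⇒< m≤x λ { refl → ¬Px Pm }) Pm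
  ...   | c , m≤c , c<x , Pc , gap = c , m≤c , m<n⇒m<1+n c<x , Pc , gap′
    where
    gap′ : ∀ d → c < d → d < suc x → ¬ P d
    gap′ d c<d d≤x with d ≟ x
    ... | yes refl = ¬Px
    ... | no d≢x   = gap d c<d (≤∧≢⇒< (≤-pred d≤x) d≢x)

  nearest-above : ∀ x k → P (suc x + k) →
    ∃ λ c → x < c × c ≤ suc x + k × P c × (∀ d → x < d → d < c → ¬ P d)
  nearest-above x k Pm with P? (suc x)
  ... | yes Px =
    suc x , ≤-refl , s≤s (m≤m+n x k) , Px , λ d x<d d≤x _ → <⇒≱ x<d (≤-pred d≤x)
  nearest-above x zero      Pm | no ¬Px = contradiction (subst P (cong suc (+-identityʳ x)) Pm) ¬Px
  nearest-above x (suc k)   Pm | no ¬Px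
    with nearest-above (suc x) k (subst P (cong suc (+-suc x k)) Pm)
  ... | c , x<c , c≤ , Pc , gap =
    c , <-trans (n<1+n x) x<c , subst (c ≤_) (cong suc (sym (+-suc x k))) c≤ , Pc , gap′
    where
    gap′ : ∀ d → x < d → d < c → ¬ P d
    gap′ d x<d d<c with d ≟ suc x
    ... | yes refl = ¬Px
    ... | no d≢x   = gap d (≤∧≢⇒< x<d (d≢x ∘ sym)) d<c

vertex? : ∀ {n} (D : Drawing n) a b → Dec (Vertex D a b)
vertex? D a b = any? λ i → let r = rect D i in
  ((a ≟ x₁ r) ⊎-dec (a ≟ x₂ r)) ×-dec ((b ≟ y₁ r) ⊎-dec (b ≟ y₂ r))

module _ {n} (D : Drawing n) {x y} (k : Fin n) (v : Vertex D x y)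
  (side : y ≡ y₁ (rect D k) ⊎ y ≡ y₂ (rect D k)) where

  edge-ending-at : x₁ (rect D k) < x → x ≤ x₂ (rect D k) → ∃ λ c → IsEdge D (hor y c x)
  edge-ending-at left right with nearest-below (λ c → vertex? D c y) x left (k , inj₁ refl , side)
  ... | c , k≤c , c<x , vc , gap = c , c<x , vc , v , gap , k , side , k≤c , right

  edge-starting-at : x₁ (rect D k) ≤ x → x < x₂ (rect D k) → ∃ λ c → IsEdge D (hor y x c)
  edge-starting-at left right with m≤n⇒∃[o]m+o≡n right
  ... | o , eq with nearest-above (λ c → vertex? D c y) x o
                      (subst (λ c → Vertex D c y) (sym eq) (k , inj₂ refl , side))
  ...   | c , x<c , c≤ , vc , gap = c , x<c , v , vc , gap , k , side , left , subst (c ≤_) eq c≤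

-- Replacing two rectangles of a diagonal drawing

≅-refl : ∀ {n} (D : Drawing n) → D ≅ D
≅-refl D = ↔-id _ , (λ _ _ → mk⇔ id id) , (λ _ _ → mk⇔ id id)

module Replacement {n} {D : Drawing n} (diag : DiagonalDrawing D)
  {X Y : Fin n} (X≢Y : X ≢ Y) (M F : Rect) where

  open Diagonal diag

  D′ : Drawing n
  D′ = drawing (N D) (updateAt (updateAt (rect D) X λ _ → M) Y λ _ → F)

  at-X : rect D′ X ≡ M
  at-X = trans (updateAt-minimal X Y _ X≢Y) (updateAt-updates X (rect D))

  at-Y : rect D′ Y ≡ F
  at-Y = updateAt-updates Y _

  elsewhere : ∀ k → k ≢ X → k ≢ Y → rect D′ k ≡ rect D k
  elsewhere k k≢X k≢Y = trans (updateAt-minimal k Y _ k≢Y) (updateAt-minimal k X _ k≢X)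

  position : ∀ k → k ≡ X ⊎ k ≡ Y ⊎ (k ≢ X × k ≢ Y)
  position k with k ≟ᶠ X | k ≟ᶠ Y
  ... | yes k≡X | _       = inj₁ k≡X
  ... | no _    | yes k≡Y = inj₂ (inj₁ k≡Y)
  ... | no k≢X  | no k≢Y  = inj₂ (inj₂ (k≢X , k≢Y))

  ∀-rect′ : ∀ (P : Rect → Set) → P M → P F → (∀ k → P (rect D k)) → ∀ k → P (rect D′ k)
  ∀-rect′ P PM PF P-old k with position k
  ... | inj₁ refl                  = subst P (sym at-X) PM
  ... | inj₂ (inj₁ refl)           = subst P (sym at-Y) PF
  ... | inj₂ (inj₂ (k≢X , k≢Y))   = subst P (sym (elsewhere k k≢X k≢Y)) (P-old k)

  SideInterior′ : ℕ → ℕ → Set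
  SideInterior′ a b = ∃ λ k → OnSideInterior (rect D′ k) a b

  record Valid (p q : ℕ) : Set where
    field
      M-within     : WithinSquare (N D) M
      F-within     : WithinSquare (N D) F
      M-meets      : MeetsDiag (N D) M
      F-meets      : MeetsDiag (N D) F
      M∩F-empty    : ∀ a b → Covers M a b → Covers F a b → ⊥
      new⊆old      : ∀ {a b} → Covers M a b ⊎ Covers F a b →
                     Covers (rect D X) a b ⊎ Covers (rect D Y) a b
      old⊆new      : ∀ {a b} → Covers (rect D X) a b ⊎ Covers (rect D Y) a b →
                     Covers M a b ⊎ Covers F a b
      new-corners  : ∀ {a b} → Corner M a b ⊎ Corner F a b → Vertex D a b ⊎ (a ≡ p × b ≡ q)
      p+q≢N        : p + q ≢ N D
      degree-new   : InteriorPoint (N D) p q → SideInterior′ p q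
      degree-old   : ∀ {a b} → InteriorPoint (N D) a b → Vertex D a b →
                     OnSideInterior (rect D X) a b ⊎ OnSideInterior (rect D Y) a b →
                     SideInterior′ a b

  module _ {p q} (valid : Valid p q) where
    open Valid valid

    cell-at : ∀ {r s a b} → r ≡ s → Covers r a b → Covers s a b
    cell-at refl c = c

    apart : ∀ {l a b} → l ≢ X → l ≢ Y →
      Covers (rect D X) a b ⊎ Covers (rect D Y) a b → Covers (rect D l) a b → ⊥
    apart l≢X _ (inj₁ cX) cl = separated⇒no-common-cell (separated _ X l≢X) cl cX
    apart _ l≢Y (inj₂ cY) cl = separated⇒no-common-cell (separated _ Y l≢Y) cl cY

    disjoint′ : ∀ k l → k ≢ l → ∀ a b → Covers (rect D′ k) a b → Covers (rect D′ l) a b → ⊥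
    disjoint′ k l k≢l a b ck cl with position k | position l
    ... | inj₁ refl        | inj₁ refl        = k≢l refl
    ... | inj₂ (inj₁ refl) | inj₂ (inj₁ refl) = k≢l refl
    ... | inj₁ refl        | inj₂ (inj₁ refl) = M∩F-empty a b (cell-at at-X ck) (cell-at at-Y cl)
    ... | inj₂ (inj₁ refl) | inj₁ refl        = M∩F-empty a b (cell-at at-X cl) (cell-at at-Y ck)
    ... | inj₁ refl        | inj₂ (inj₂ (l≢X , l≢Y)) =
      apart l≢X l≢Y (new⊆old (inj₁ (cell-at at-X ck))) (cell-at (elsewhere l l≢X l≢Y) cl)
    ... | inj₂ (inj₁ refl) | inj₂ (inj₂ (l≢X , l≢Y)) =
      apart l≢X l≢Y (new⊆old (inj₂ (cell-at at-Y ck))) (cell-at (elsewhere l l≢X l≢Y) cl)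
    ... | inj₂ (inj₂ (k≢X , k≢Y)) | inj₁ refl =
      apart k≢X k≢Y (new⊆old (inj₁ (cell-at at-X cl))) (cell-at (elsewhere k k≢X k≢Y) ck)
    ... | inj₂ (inj₂ (k≢X , k≢Y)) | inj₂ (inj₁ refl) =
      apart k≢X k≢Y (new⊆old (inj₂ (cell-at at-Y cl))) (cell-at (elsewhere k k≢X k≢Y) ck)
    ... | inj₂ (inj₂ (k≢X , k≢Y)) | inj₂ (inj₂ (l≢X , l≢Y)) =
      separated⇒no-common-cell (separated k l k≢l)
        (cell-at (elsewhere k k≢X k≢Y) ck) (cell-at (elsewhere l l≢X l≢Y) cl)

    covered-by-new : ∀ {a b} → Covers M a b ⊎ Covers F a b → ∃ λ k → Covers (rect D′ k) a b
    covered-by-new (inj₁ cM) = X , cell-at (sym at-X) cM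
    covered-by-new (inj₂ cF) = Y , cell-at (sym at-Y) cF

    covered′ : ∀ a b → a < N D → b < N D → ∃ λ k → Covers (rect D′ k) a b
    covered′ a b a<N b<N with covered a b a<N b<N
    ... | k , ck with position k
    ...   | inj₁ refl               = covered-by-new (old⊆new (inj₁ ck))
    ...   | inj₂ (inj₁ refl)        = covered-by-new (old⊆new (inj₂ ck))
    ...   | inj₂ (inj₂ (k≢X , k≢Y)) = k , cell-at (sym (elsewhere k k≢X k≢Y)) ck

    vertex′ : ∀ {a b} → Vertex D′ a b → Vertex D a b ⊎ (a ≡ p × b ≡ q)
    vertex′ {a} {b} (k , corner) with position k
    ... | inj₁ refl        = new-corners (inj₁ (subst (λ r → Corner r a b) at-X corner))
    ... | inj₂ (inj₁ refl) = new-corners (inj₂ (subst (λ r → Corner r a b) at-Y corner))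
    ... | inj₂ (inj₂ (k≢X , k≢Y)) =
      inj₁ (k , subst (λ r → Corner r a b) (elsewhere k k≢X k≢Y) corner)

    degree′ : ∀ a b → InteriorPoint (N D) a b → Vertex D′ a b → SideInterior′ a b
    degree′ a b interior v with vertex′ v
    ... | inj₂ (refl , refl) = degree-new interior
    ... | inj₁ old with degree-three a b interior old
    ...   | k , side with position k
    ...     | inj₁ refl        = degree-old interior old (inj₁ side)
    ...     | inj₂ (inj₁ refl) = degree-old interior old (inj₂ side)
    ...     | inj₂ (inj₂ (k≢X , k≢Y)) =
      k , subst (λ r → OnSideInterior r a b) (sym (elsewhere k k≢X k≢Y)) side

    off-diagonal′ : ∀ a b → Vertex D′ a b → OffDiag (N D) a b
    off-diagonal′ a b v with vertex′ v
    ... | inj₁ old           = off-diagonal a b old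
    ... | inj₂ (refl , refl) = inj₁ p+q≢N

    within-square′ : ∀ k → WithinSquare (N D) (rect D′ k)
    within-square′ = ∀-rect′ (WithinSquare (N D)) M-within F-within within-square

    diagonal′ : DiagonalDrawing D′
    diagonal′ =
      ( proj₁ rectangulation
      , within-square′
      , (λ k l k≢l →
           no-common-cell⇒separated (within-square′ k) (within-square′ l) (disjoint′ k l k≢l))
      , covered′
      , (λ a b a>0 a<N b>0 b<N → degree′ a b (a>0 , a<N , b>0 , b<N)) )
      , ∀-rect′ (MeetsDiag (N D)) M-meets F-meets meets-diagonal
      , off-diagonal′

    diagonal-rectangulation′ : IsDiagonalRectangulation D′
    diagonal-rectangulation′ = proj₁ diagonal′ , D′ , diagonal′ , ≅-refl D′

-- Rotating an edge above the diagonal about its left end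

-- Rotating the edge [x,x'] × {y} about (x , y) replaces X and Y by M (X
-- stretched up to the top of Y) and F (the part of Y left of x), creating
-- the vertex (x , b₂).
module RotationAboutLo {n} {D : Drawing n} (diag : DiagonalDrawing D)
  {X Y : Fin n} (X≢Y : X ≢ Y) {x x' a b₁ y b₂ : ℕ}
  (X≡ : rect D X ≡ mkRect x x' b₁ y) (Y≡ : rect D Y ≡ mkRect a x' y b₂)
  (a<x : a < x) (above : N D < x + y)
  (no-inner-vertex : ∀ c → x < c → c < x' → ¬ Vertex D c y) where

  open Diagonal diag
  open Replacement diag X≢Y (mkRect x x' b₁ b₂) (mkRect a x y b₂)

  via-X : ∀ (P : Rect → Set) → P (rect D X) → P (mkRect x x' b₁ y)
  via-X P = subst P X≡

  via-Y : ∀ (P : Rect → Set) → P (rect D Y) → P (mkRect a x' y b₂)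
  via-Y P = subst P Y≡

  to-X : ∀ (P : Rect → Set) → P (mkRect x x' b₁ y) → P (rect D X)
  to-X P = subst P (sym X≡)

  to-Y : ∀ (P : Rect → Set) → P (mkRect a x' y b₂) → P (rect D Y)
  to-Y P = subst P (sym Y≡)

  within-X : WithinSquare (N D) (mkRect x x' b₁ y)
  within-X = via-X (WithinSquare (N D)) (within-square X)

  within-Y : WithinSquare (N D) (mkRect a x' y b₂)
  within-Y = via-Y (WithinSquare (N D)) (within-square Y)

  x<x' : x < x'
  x<x' = proj₁ within-X

  b₁<y : b₁ < y
  b₁<y = proj₁ (proj₂ within-X)

  y<b₂ : y < b₂
  y<b₂ = proj₁ (proj₂ within-Y)

  x'≤N : x' ≤ N D
  x'≤N = proj₁ (proj₂ (proj₂ within-Y))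

  b₂≤N : b₂ ≤ N D
  b₂≤N = proj₂ (proj₂ (proj₂ within-Y))

  N<x+b₂ : N D < x + b₂
  N<x+b₂ = <-≤-trans above (+-monoʳ-≤ x (<⇒≤ y<b₂))

  new⊆old : ∀ {c d} → Covers (mkRect x x' b₁ b₂) c d ⊎ Covers (mkRect a x y b₂) c d →
    Covers (rect D X) c d ⊎ Covers (rect D Y) c d
  new⊆old {c} {d} (inj₁ (x≤c , c<x' , b₁≤d , d<b₂)) with d <? y
  ... | yes d<y = inj₁ (to-X (λ r → Covers r c d) (x≤c , c<x' , b₁≤d , d<y))
  ... | no  d≮y =
    inj₂ (to-Y (λ r → Covers r c d) (≤-trans (<⇒≤ a<x) x≤c , c<x' , ≮⇒≥ d≮y , d<b₂))
  new⊆old {c} {d} (inj₂ (a≤c , c<x , y≤d , d<b₂)) =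
    inj₂ (to-Y (λ r → Covers r c d) (a≤c , <-trans c<x x<x' , y≤d , d<b₂))

  old⊆new : ∀ {c d} → Covers (rect D X) c d ⊎ Covers (rect D Y) c d →
    Covers (mkRect x x' b₁ b₂) c d ⊎ Covers (mkRect a x y b₂) c d
  old⊆new {c} {d} (inj₁ cX) with via-X (λ r → Covers r c d) cX
  ... | x≤c , c<x' , b₁≤d , d<y = inj₁ (x≤c , c<x' , b₁≤d , <-trans d<y y<b₂)
  old⊆new {c} {d} (inj₂ cY) with via-Y (λ r → Covers r c d) cY | c <? x
  ... | a≤c , _ , y≤d , d<b₂ | yes c<x = inj₂ (a≤c , c<x , y≤d , d<b₂)
  ... | _ , c<x' , y≤d , d<b₂ | no c≮x =
    inj₁ (≮⇒≥ c≮x , c<x' , ≤-trans (<⇒≤ b₁<y) y≤d , d<b₂)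

  new-corners : ∀ {c d} → Corner (mkRect x x' b₁ b₂) c d ⊎ Corner (mkRect a x y b₂) c d →
    Vertex D c d ⊎ (c ≡ x × d ≡ b₂)
  new-corners (inj₁ (c≈ , inj₁ d≡b₁))        = inj₁ (X , to-X (λ r → Corner r _ _) (c≈ , inj₁ d≡b₁))
  new-corners (inj₁ (inj₁ c≡x , inj₂ d≡b₂))  = inj₂ (c≡x , d≡b₂)
  new-corners (inj₁ (inj₂ c≡x' , inj₂ d≡b₂)) = inj₁ (Y , to-Y (λ r → Corner r _ _) (inj₂ c≡x' , inj₂ d≡b₂))
  new-corners (inj₂ (inj₁ c≡a , d≈))         = inj₁ (Y , to-Y (λ r → Corner r _ _) (inj₁ c≡a , d≈))
  new-corners (inj₂ (inj₂ c≡x , inj₁ d≡y))   = inj₁ (X , to-X (λ r → Corner r _ _) (inj₁ c≡x , inj₂ d≡y))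
  new-corners (inj₂ (inj₂ c≡x , inj₂ d≡b₂))  = inj₂ (c≡x , d≡b₂)

  degree-new : InteriorPoint (N D) x b₂ → SideInterior′ x b₂
  degree-new (_ , _ , _ , b₂<N)
    with top-side-point-above-diagonal {k = Y}
           (to-Y (λ r → x₁ r ≤ x) (<⇒≤ a<x)) (to-Y (λ r → x < x₂ r) x<x')
           (cong y₂ Y≡) b₂<N N<x+b₂
  ... | V , b₂≡ , left , right =
    V , subst (λ r → OnSideInterior r x b₂) (sym (elsewhere V V≢X V≢Y)) (inj₂ (inj₁ b₂≡ , left , right))
    where
    V≢X : V ≢ X
    V≢X refl = <⇒≱ (<-trans b₁<y y<b₂) (≤-reflexive (trans b₂≡ (cong y₁ X≡)))
    V≢Y : V ≢ Y
    V≢Y refl = <⇒≱ y<b₂ (≤-reflexive (trans b₂≡ (cong y₁ Y≡)))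

  in-M : ∀ {c d} → OnSideInterior (mkRect x x' b₁ b₂) c d → SideInterior′ c d
  in-M {c} {d} s = X , subst (λ r → OnSideInterior r c d) (sym at-X) s

  in-F : ∀ {c d} → OnSideInterior (mkRect a x y b₂) c d → SideInterior′ c d
  in-F {c} {d} s = Y , subst (λ r → OnSideInterior r c d) (sym at-Y) s

  degree-old : ∀ {c d} → InteriorPoint (N D) c d → Vertex D c d →
    OnSideInterior (rect D X) c d ⊎ OnSideInterior (rect D Y) c d → SideInterior′ c d
  degree-old {c} {d} _ v (inj₁ sX) with via-X (λ r → OnSideInterior r c d) sX
  ... | inj₁ (c≈ , b₁<d , d<y)        = in-M (inj₁ (c≈ , b₁<d , <-trans d<y y<b₂))
  ... | inj₂ (inj₁ d≡b₁ , x<c , c<x') = in-M (inj₂ (inj₁ d≡b₁ , x<c , c<x'))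
  ... | inj₂ (inj₂ refl , x<c , c<x') = contradiction v (no-inner-vertex c x<c c<x')
  degree-old {c} {d} interior v (inj₂ sY) with via-Y (λ r → OnSideInterior r c d) sY
  ... | inj₁ (inj₁ c≡a , y<d , d<b₂)  = in-F (inj₁ (inj₁ c≡a , y<d , d<b₂))
  ... | inj₁ (inj₂ c≡x' , y<d , d<b₂) = in-M (inj₁ (inj₂ c≡x' , <-trans b₁<y y<d , d<b₂))
  ... | inj₂ (inj₁ refl , a<c , c<x') with <-cmp c x
  ...   | tri< c<x _ _  = in-F (inj₂ (inj₁ refl , a<c , c<x))
  ...   | tri≈ _ refl _ = in-M (inj₁ (inj₁ refl , b₁<y , y<b₂))
  ...   | tri> _ _ x<c  = contradiction v (no-inner-vertex c x<c c<x')
  degree-old {c} {d} interior v (inj₂ sY) | inj₂ (inj₂ refl , a<c , c<x') with <-cmp c x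
  ...   | tri< c<x _ _  = in-F (inj₂ (inj₂ refl , a<c , c<x))
  ...   | tri≈ _ refl _ = degree-new interior
  ...   | tri> _ _ x<c  = in-M (inj₂ (inj₂ refl , x<c , c<x'))

  valid : Valid x b₂
  valid = record
    { M-within    = x<x' , <-trans b₁<y y<b₂ , x'≤N , b₂≤N
    ; F-within    = a<x , y<b₂ , ≤-trans (<⇒≤ x<x') x'≤N , b₂≤N
    ; M-meets     = proj₁ (via-X (MeetsDiag (N D)) (meets-diagonal X))
                  , proj₂ (via-Y (MeetsDiag (N D)) (meets-diagonal Y))
    ; F-meets     = proj₁ (via-Y (MeetsDiag (N D)) (meets-diagonal Y)) , <⇒≤ N<x+b₂
    ; M∩F-empty   = λ _ _ (x≤c , _) (_ , c<x , _) → <⇒≱ c<x x≤c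
    ; new⊆old     = new⊆old
    ; old⊆new     = old⊆new
    ; new-corners = new-corners
    ; p+q≢N       = λ eq → <-irrefl (sym eq) N<x+b₂
    ; degree-new  = degree-new
    ; degree-old  = degree-old
    }

  rotated : RotatedAbout D (hor y x x') lo D′
  rotated = refl , X , Y , X≢Y , separates , rotation-step , elsewhere
    where
    separates : Separates D (hor y x x') X Y
    separates rewrite X≡ | Y≡ = inj₁ (refl , refl) , ≤-refl , ≤-refl , <⇒≤ a<x , ≤-refl
    rotation-step : RotStep D (hor y x x') lo X Y (rect D′ X) (rect D′ Y)
    rotation-step rewrite X≡ | Y≡ =
      refl , a<x ,
      trans at-X (sym (cong₂ (mkRect x x') (m≤n⇒m⊓n≡m (<⇒≤ b₁<y)) (m≤n⇒m⊔n≡n (<⇒≤ y<b₂)))) ,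
      at-Y

  rotation : ∃ λ D″ → RotatedAbout D (hor y x x') lo D″ × IsDiagonalRectangulation D″
  rotation = D′ , rotated , diagonal-rectangulation′ valid

-- Rotating an edge below the diagonal about its right end

-- The point reflection of RotationAboutLo: M is X stretched down to the
-- bottom of Y, F the part of Y right of x', and the new vertex is (x' , b₁).
module RotationAboutHi {n} {D : Drawing n} (diag : DiagonalDrawing D)
  {X Y : Fin n} (X≢Y : X ≢ Y) {x x' a b₁ y b₂ : ℕ}
  (X≡ : rect D X ≡ mkRect x x' y b₂) (Y≡ : rect D Y ≡ mkRect x a b₁ y)
  (x'<a : x' < a) (below : x' + y < N D)
  (no-inner-vertex : ∀ c → x < c → c < x' → ¬ Vertex D c y) where

  open Diagonal diag
  open Replacement diag X≢Y (mkRect x x' b₁ b₂) (mkRect x' a b₁ y)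

  via-X : ∀ (P : Rect → Set) → P (rect D X) → P (mkRect x x' y b₂)
  via-X P = subst P X≡

  via-Y : ∀ (P : Rect → Set) → P (rect D Y) → P (mkRect x a b₁ y)
  via-Y P = subst P Y≡

  to-X : ∀ (P : Rect → Set) → P (mkRect x x' y b₂) → P (rect D X)
  to-X P = subst P (sym X≡)

  to-Y : ∀ (P : Rect → Set) → P (mkRect x a b₁ y) → P (rect D Y)
  to-Y P = subst P (sym Y≡)

  within-X : WithinSquare (N D) (mkRect x x' y b₂)
  within-X = via-X (WithinSquare (N D)) (within-square X)

  within-Y : WithinSquare (N D) (mkRect x a b₁ y)
  within-Y = via-Y (WithinSquare (N D)) (within-square Y)

  x<x' : x < x'
  x<x' = proj₁ within-X

  y<b₂ : y < b₂
  y<b₂ = proj₁ (proj₂ within-X)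

  b₁<y : b₁ < y
  b₁<y = proj₁ (proj₂ within-Y)

  x'≤N : x' ≤ N D
  x'≤N = proj₁ (proj₂ (proj₂ within-X))

  b₂≤N : b₂ ≤ N D
  b₂≤N = proj₂ (proj₂ (proj₂ within-X))

  a≤N : a ≤ N D
  a≤N = proj₁ (proj₂ (proj₂ within-Y))

  y≤N : y ≤ N D
  y≤N = proj₂ (proj₂ (proj₂ within-Y))

  x'+b₁<N : x' + b₁ < N D
  x'+b₁<N = ≤-<-trans (+-monoʳ-≤ x' (<⇒≤ b₁<y)) below

  new⊆old : ∀ {c d} → Covers (mkRect x x' b₁ b₂) c d ⊎ Covers (mkRect x' a b₁ y) c d →
    Covers (rect D X) c d ⊎ Covers (rect D Y) c d
  new⊆old {c} {d} (inj₁ (x≤c , c<x' , b₁≤d , d<b₂)) with d <? y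
  ... | yes d<y = inj₂ (to-Y (λ r → Covers r c d) (x≤c , <-trans c<x' x'<a , b₁≤d , d<y))
  ... | no  d≮y = inj₁ (to-X (λ r → Covers r c d) (x≤c , c<x' , ≮⇒≥ d≮y , d<b₂))
  new⊆old {c} {d} (inj₂ (x'≤c , c<a , b₁≤d , d<y)) =
    inj₂ (to-Y (λ r → Covers r c d) (≤-trans (<⇒≤ x<x') x'≤c , c<a , b₁≤d , d<y))

  old⊆new : ∀ {c d} → Covers (rect D X) c d ⊎ Covers (rect D Y) c d →
    Covers (mkRect x x' b₁ b₂) c d ⊎ Covers (mkRect x' a b₁ y) c d
  old⊆new {c} {d} (inj₁ cX) with via-X (λ r → Covers r c d) cX
  ... | x≤c , c<x' , y≤d , d<b₂ = inj₁ (x≤c , c<x' , ≤-trans (<⇒≤ b₁<y) y≤d , d<b₂)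
  old⊆new {c} {d} (inj₂ cY) with via-Y (λ r → Covers r c d) cY | c <? x'
  ... | x≤c , _ , b₁≤d , d<y | yes c<x' = inj₁ (x≤c , c<x' , b₁≤d , <-trans d<y y<b₂)
  ... | _ , c<a , b₁≤d , d<y | no c≮x'  = inj₂ (≮⇒≥ c≮x' , c<a , b₁≤d , d<y)

  new-corners : ∀ {c d} → Corner (mkRect x x' b₁ b₂) c d ⊎ Corner (mkRect x' a b₁ y) c d →
    Vertex D c d ⊎ (c ≡ x' × d ≡ b₁)
  new-corners (inj₁ (c≈ , inj₂ d≡b₂))        = inj₁ (X , to-X (λ r → Corner r _ _) (c≈ , inj₂ d≡b₂))
  new-corners (inj₁ (inj₁ c≡x , inj₁ d≡b₁))  = inj₁ (Y , to-Y (λ r → Corner r _ _) (inj₁ c≡x , inj₁ d≡b₁))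
  new-corners (inj₁ (inj₂ c≡x' , inj₁ d≡b₁)) = inj₂ (c≡x' , d≡b₁)
  new-corners (inj₂ (inj₂ c≡a , d≈))         = inj₁ (Y , to-Y (λ r → Corner r _ _) (inj₂ c≡a , d≈))
  new-corners (inj₂ (inj₁ c≡x' , inj₂ d≡y))  = inj₁ (X , to-X (λ r → Corner r _ _) (inj₂ c≡x' , inj₁ d≡y))
  new-corners (inj₂ (inj₁ c≡x' , inj₁ d≡b₁)) = inj₂ (c≡x' , d≡b₁)

  degree-new : InteriorPoint (N D) x' b₁ → SideInterior′ x' b₁
  degree-new (_ , _ , b₁>0 , _)
    with bottom-side-point-below-diagonal {k = Y}
           (to-Y (λ r → x₁ r < x') x<x') (to-Y (λ r → x' < x₂ r) x'<a)
           (cong y₁ Y≡) b₁>0 x'+b₁<N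
  ... | V , b₁≡ , left , right =
    V , subst (λ r → OnSideInterior r x' b₁) (sym (elsewhere V V≢X V≢Y)) (inj₂ (inj₂ b₁≡ , left , right))
    where
    V≢X : V ≢ X
    V≢X refl = <⇒≱ (<-trans b₁<y y<b₂) (≤-reflexive (sym (trans b₁≡ (cong y₂ X≡))))
    V≢Y : V ≢ Y
    V≢Y refl = <⇒≱ b₁<y (≤-reflexive (sym (trans b₁≡ (cong y₂ Y≡))))

  in-M : ∀ {c d} → OnSideInterior (mkRect x x' b₁ b₂) c d → SideInterior′ c d
  in-M {c} {d} s = X , subst (λ r → OnSideInterior r c d) (sym at-X) s

  in-F : ∀ {c d} → OnSideInterior (mkRect x' a b₁ y) c d → SideInterior′ c d
  in-F {c} {d} s = Y , subst (λ r → OnSideInterior r c d) (sym at-Y) s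

  degree-old : ∀ {c d} → InteriorPoint (N D) c d → Vertex D c d →
    OnSideInterior (rect D X) c d ⊎ OnSideInterior (rect D Y) c d → SideInterior′ c d
  degree-old {c} {d} _ v (inj₁ sX) with via-X (λ r → OnSideInterior r c d) sX
  ... | inj₁ (c≈ , y<d , d<b₂)        = in-M (inj₁ (c≈ , <-trans b₁<y y<d , d<b₂))
  ... | inj₂ (inj₁ refl , x<c , c<x') = contradiction v (no-inner-vertex c x<c c<x')
  ... | inj₂ (inj₂ d≡b₂ , x<c , c<x') = in-M (inj₂ (inj₂ d≡b₂ , x<c , c<x'))
  degree-old {c} {d} interior v (inj₂ sY) with via-Y (λ r → OnSideInterior r c d) sY
  ... | inj₁ (inj₁ c≡x , b₁<d , d<y) = in-M (inj₁ (inj₁ c≡x , b₁<d , <-trans d<y y<b₂))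
  ... | inj₁ (inj₂ c≡a , b₁<d , d<y) = in-F (inj₁ (inj₂ c≡a , b₁<d , d<y))
  ... | inj₂ (inj₁ refl , x<c , c<a) with <-cmp c x'
  ...   | tri< c<x' _ _ = in-M (inj₂ (inj₁ refl , x<c , c<x'))
  ...   | tri≈ _ refl _ = degree-new interior
  ...   | tri> _ _ x'<c = in-F (inj₂ (inj₁ refl , x'<c , c<a))
  degree-old {c} {d} interior v (inj₂ sY) | inj₂ (inj₂ refl , x<c , c<a) with <-cmp c x'
  ...   | tri< c<x' _ _ = contradiction v (no-inner-vertex c x<c c<x')
  ...   | tri≈ _ refl _ = in-M (inj₁ (inj₂ refl , b₁<y , y<b₂))
  ...   | tri> _ _ x'<c = in-F (inj₂ (inj₂ refl , x'<c , c<a))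

  valid : Valid x' b₁
  valid = record
    { M-within    = x<x' , <-trans b₁<y y<b₂ , x'≤N , b₂≤N
    ; F-within    = x'<a , b₁<y , a≤N , y≤N
    ; M-meets     = proj₁ (via-Y (MeetsDiag (N D)) (meets-diagonal Y))
                  , proj₂ (via-X (MeetsDiag (N D)) (meets-diagonal X))
    ; F-meets     = <⇒≤ x'+b₁<N , proj₂ (via-Y (MeetsDiag (N D)) (meets-diagonal Y))
    ; M∩F-empty   = λ _ _ (_ , c<x' , _) (x'≤c , _) → <⇒≱ c<x' x'≤c
    ; new⊆old     = new⊆old
    ; old⊆new     = old⊆new
    ; new-corners = new-corners
    ; p+q≢N       = λ eq → <-irrefl eq x'+b₁<N
    ; degree-new  = degree-new
    ; degree-old  = degree-old
    }

  rotated : RotatedAbout D (hor y x x') hi D′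
  rotated = refl , X , Y , X≢Y , separates , rotation-step , elsewhere
    where
    separates : Separates D (hor y x x') X Y
    separates rewrite X≡ | Y≡ = inj₂ (refl , refl) , ≤-refl , ≤-refl , ≤-refl , <⇒≤ x'<a
    rotation-step : RotStep D (hor y x x') hi X Y (rect D′ X) (rect D′ Y)
    rotation-step rewrite X≡ | Y≡ =
      refl , x'<a ,
      trans at-X (sym (cong₂ (mkRect x x') (m≥n⇒m⊓n≡n (<⇒≤ b₁<y)) (m≥n⇒m⊔n≡m (<⇒≤ y<b₂)))) ,
      at-Y

  rotation : ∃ λ D″ → RotatedAbout D (hor y x x') hi D″ × IsDiagonalRectangulation D″
  rotation = D′ , rotated , diagonal-rectangulation′ valid

SimpleOrOffDiagonalRotation : ∀ {n} → Drawing n → Edge → Set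
SimpleOrOffDiagonalRotation D e =
  SimplyFlippable D e ⊎ (FlippableByRotation D e × ¬ IntersectsDiag (N D) e)

-- The edge [x , suc x'₀] × {suc y₀}, given by the components of IsEdge;
-- the rows of cells along it are suc y₀ above and y₀ below.
module HorizontalEdge {n} {D : Drawing n} (diag : DiagonalDrawing D) {y₀ x x'₀ : ℕ}
  (x≤x'₀ : x ≤ x'₀) (v-lo : Vertex D x (suc y₀)) (v-hi : Vertex D (suc x'₀) (suc y₀))
  (no-inner-vertex : ∀ c → x < c → c < suc x'₀ → ¬ Vertex D c (suc y₀))
  (K : Fin n) (K-side : suc y₀ ≡ y₁ (rect D K) ⊎ suc y₀ ≡ y₂ (rect D K))
  (K-left : x₁ (rect D K) ≤ x) (K-right : suc x'₀ ≤ x₂ (rect D K))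
  (y<N : suc y₀ < N D) where

  open Diagonal diag

  y x' : ℕ
  y  = suc y₀
  x' = suc x'₀

  e : Edge
  e = hor y x x'

  x<x' : x < x'
  x<x' = s≤s x≤x'₀

  x'₀<x' : x'₀ < x'
  x'₀<x' = n<1+n x'₀

  x'≤N : x' ≤ N D
  x'≤N = ≤-trans K-right (x₂≤N K)

  x<N : x < N D
  x<N = <-≤-trans x<x' x'≤N

  y₀<N : y₀ < N D
  y₀<N = <⇒≤ y<N

  K-covers : ∀ {c} → x ≤ c → c < x' →
    (y ≡ y₁ (rect D K) × Covers (rect D K) c y) ⊎ (y ≡ y₂ (rect D K) × Covers (rect D K) c y₀)
  K-covers {c} x≤c c<x' = along K-side
    where
    along : y ≡ y₁ (rect D K) ⊎ y ≡ y₂ (rect D K) →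
      (y ≡ y₁ (rect D K) × Covers (rect D K) c y) ⊎ (y ≡ y₂ (rect D K) × Covers (rect D K) c y₀)
    along (inj₁ bottom) =
      inj₁ (bottom , ≤-trans K-left x≤c , <-≤-trans c<x' K-right , ≤-reflexive (sym bottom)
                   , subst (_< y₂ (rect D K)) (sym bottom) (y₁<y₂ K))
    along (inj₂ top) =
      inj₂ (top , ≤-trans K-left x≤c , <-≤-trans c<x' K-right
                , ≤-pred (subst (y₁ (rect D K) <_) (sym top) (y₁<y₂ K)) , ≤-reflexive top)

  bottom-on-edge : ∀ {k c} → x ≤ c → c < x' → Covers (rect D k) c y → y₁ (rect D k) ≡ y
  bottom-on-edge x≤c c<x' ck@(k-left , k-right , y₁≤y , y<y₂) with m≤n⇒m<n∨m≡n y₁≤y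
  ... | inj₂ y₁≡y = y₁≡y
  ... | inj₁ (s≤s y₁≤y₀) with K-covers x≤c c<x'
  ...   | inj₁ (bottom , cK) with covers-unique ck cK
  ...     | refl = contradiction bottom (<⇒≢ (s≤s y₁≤y₀) ∘ sym)
  bottom-on-edge x≤c c<x' (k-left , k-right , _ , y<y₂) | inj₁ (s≤s y₁≤y₀) | inj₂ (top , cK)
    with covers-unique (k-left , k-right , y₁≤y₀ , <-trans (n<1+n y₀) y<y₂) cK
  ... | refl = contradiction y<y₂ (<-irrefl top)

  top-on-edge : ∀ {k c} → x ≤ c → c < x' → Covers (rect D k) c y₀ → y₂ (rect D k) ≡ y
  top-on-edge x≤c c<x' ck@(k-left , k-right , y₁≤y₀ , y₀<y₂) with m≤n⇒m<n∨m≡n y₀<y₂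
  ... | inj₂ y≡y₂ = sym y≡y₂
  ... | inj₁ y<y₂ with K-covers x≤c c<x'
  ...   | inj₂ (top , cK) with covers-unique ck cK
  ...     | refl = contradiction y<y₂ (<-irrefl top)
  top-on-edge x≤c c<x' (k-left , k-right , y₁≤y₀ , _) | inj₁ y<y₂ | inj₁ (bottom , cK)
    with covers-unique (k-left , k-right , ≤-trans y₁≤y₀ (n≤1+n y₀) , y<y₂) cK
  ... | refl = contradiction (subst (_≤ y₀) (sym bottom) y₁≤y₀) (<⇒≱ ≤-refl)

  -- A horizontal side through the edge can only stop at an end vertex, and
  -- cannot run on past an unmatched end.
  right-end : ∀ {k} → ¬ MatchedAt D e hi → y ≡ y₁ (rect D k) ⊎ y ≡ y₂ (rect D k) →
    x₁ (rect D k) < x' → x < x₂ (rect D k) → x₂ (rect D k) ≡ x'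
  right-end {k} ¬hi side left right = ≤-antisym
    (≮⇒≥ λ x'<x₂ → ¬hi (edge-starting-at D k v-hi side (<⇒≤ left) x'<x₂))
    (≮⇒≥ λ x₂<x' → no-inner-vertex (x₂ (rect D k)) right x₂<x' (k , inj₂ refl , side))

  left-end : ∀ {k} → ¬ MatchedAt D e lo → y ≡ y₁ (rect D k) ⊎ y ≡ y₂ (rect D k) →
    x₁ (rect D k) < x' → x < x₂ (rect D k) → x₁ (rect D k) ≡ x
  left-end {k} ¬lo side left right = ≤-antisym
    (≮⇒≥ λ x<x₁ → no-inner-vertex (x₁ (rect D k)) x<x₁ left (k , inj₁ refl , side))
    (≮⇒≥ λ x₁<x → ¬lo (edge-ending-at D k v-lo side x₁<x (<⇒≤ right)))

  left-of-cell-above : N D < x + y → ∀ {k} → Covers (rect D k) x y → x₁ (rect D k) < x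
  left-of-cell-above above {k} ck@(left , _) = ≤∧≢⇒< left λ x₁≡x → <⇒≱ above
    (subst₂ (λ u w → u + w ≤ N D) x₁≡x (bottom-on-edge ≤-refl x<x' ck)
            (proj₁ (meets-diagonal k)))

  right-of-cell-below : x' + y < N D → ∀ {k} → Covers (rect D k) x'₀ y₀ → x' < x₂ (rect D k)
  right-of-cell-below below {k} ck@(_ , right , _) = ≤∧≢⇒< right λ x'≡x₂ → <⇒≱ below
    (subst₂ (λ u w → N D ≤ u + w) (sym x'≡x₂) (top-on-edge x≤x'₀ x'₀<x' ck)
            (proj₂ (meets-diagonal k)))

  matched-lo-above : N D < x + y → MatchedAt D e lo
  matched-lo-above above with covered x y x<N y<N
  ... | k , ck@(_ , right , _) = edge-ending-at D k v-lo (inj₁ (sym (bottom-on-edge ≤-refl x<x' ck)))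
                                   (left-of-cell-above above ck) (<⇒≤ right)

  matched-hi-below : x' + y < N D → MatchedAt D e hi
  matched-hi-below below with covered x'₀ y₀ (<-≤-trans x'₀<x' x'≤N) y₀<N
  ... | k , ck@(left , _) = edge-starting-at D k v-hi (inj₂ (sym (top-on-edge x≤x'₀ x'₀<x' ck)))
                              (≤-trans left (n≤1+n x'₀)) (right-of-cell-below below ck)

  rotation-about-lo : N D < x + y → ¬ MatchedAt D e hi → FlippableByRotation D e
  rotation-about-lo above ¬hi with covered x y₀ x<N y₀<N | covered x y x<N y<N
  ... | X , cX@(X-left , X-right , _) | Y , cY@(Y-left , Y-right , _) =
    lo , matched-lo-above above , ¬hi ,
    RotationAboutLo.rotation diag X≢Y (rect-≡ x₁X x₂X refl y₂X) (rect-≡ refl x₂Y y₁Y refl)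
      (left-of-cell-above above cY) above no-inner-vertex
    where
    y₂X : y₂ (rect D X) ≡ y
    y₂X = top-on-edge ≤-refl x<x' cX
    y₁Y : y₁ (rect D Y) ≡ y
    y₁Y = bottom-on-edge ≤-refl x<x' cY
    X≢Y : X ≢ Y
    X≢Y refl = <-irrefl (trans y₁Y (sym y₂X)) (y₁<y₂ X)
    x₂X : x₂ (rect D X) ≡ x'
    x₂X = right-end ¬hi (inj₂ (sym y₂X)) (≤-<-trans X-left x<x') X-right
    x₂Y : x₂ (rect D Y) ≡ x'
    x₂Y = right-end ¬hi (inj₁ (sym y₁Y)) (≤-<-trans Y-left x<x') Y-right
    x₁X : x₁ (rect D X) ≡ x
    x₁X = ≤-antisym X-left (≮⇒≥ λ x₁<x →
      extends-left-not-vertex cY cX (left-of-cell-above above cY) x₁<x v-lo)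

  rotation-about-hi : x' + y < N D → ¬ MatchedAt D e lo → FlippableByRotation D e
  rotation-about-hi below ¬lo with covered x'₀ y (<-≤-trans x'₀<x' x'≤N) y<N
                                 | covered x'₀ y₀ (<-≤-trans x'₀<x' x'≤N) y₀<N
  ... | X , cX@(X-left , X-right , _) | Y , cY@(Y-left , Y-right , _) =
    hi , matched-hi-below below , ¬lo ,
    RotationAboutHi.rotation diag X≢Y (rect-≡ x₁X x₂X y₁X refl) (rect-≡ x₁Y refl refl y₂Y)
      (right-of-cell-below below cY) below no-inner-vertex
    where
    y₁X : y₁ (rect D X) ≡ y
    y₁X = bottom-on-edge x≤x'₀ x'₀<x' cX
    y₂Y : y₂ (rect D Y) ≡ y
    y₂Y = top-on-edge x≤x'₀ x'₀<x' cY
    X≢Y : X ≢ Y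
    X≢Y refl = <-irrefl (trans y₁X (sym y₂Y)) (y₁<y₂ X)
    x₁X : x₁ (rect D X) ≡ x
    x₁X = left-end ¬lo (inj₁ (sym y₁X)) (≤-<-trans X-left x'₀<x') (≤-<-trans x≤x'₀ X-right)
    x₁Y : x₁ (rect D Y) ≡ x
    x₁Y = left-end ¬lo (inj₂ (sym y₂Y)) (≤-<-trans Y-left x'₀<x') (≤-<-trans x≤x'₀ Y-right)
    x₂X : x₂ (rect D X) ≡ x'
    x₂X = ≤-antisym (≮⇒≥ λ x'<x₂ →
      extends-right-not-vertex cX cY x'<x₂ (right-of-cell-below below cY) v-hi) X-right

  locked⇒matched : ∀ {p} → LockedAt D e p → MatchedAt D e p
  locked⇒matched = proj₂ ∘ proj₂

  locked-lo⇒below : LockedAt D e lo → x + y < N D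
  locked-lo⇒below (_ , inj₁ (_ , inj₁ ()) , _)
  locked-lo⇒below (_ , inj₁ (_ , inj₂ ()) , _)
  locked-lo⇒below (_ , inj₂ (below , _) , _) = below

  locked-hi⇒above : LockedAt D e hi → N D < x' + y
  locked-hi⇒above (_ , inj₁ (above , _) , _) = above
  locked-hi⇒above (_ , inj₂ (_ , inj₁ ()) , _)
  locked-hi⇒above (_ , inj₂ (_ , inj₂ ()) , _)

  endpoint-off-diagonal : ∀ {a} → Vertex D a y → a + y ≢ N D
  endpoint-off-diagonal v a+y≡N with off-diagonal _ _ v
  ... | inj₁ a+y≢N           = a+y≢N a+y≡N
  ... | inj₂ (inj₁ (_ , y≡N)) = <-irrefl y≡N y<N
  ... | inj₂ (inj₂ (_ , ()))

  edge-position : N D < x + y ⊎ x' + y < N D ⊎ (x + y < N D × N D < x' + y)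
  edge-position with <-cmp (x + y) (N D)
  ... | tri> _ _ above = inj₁ above
  ... | tri≈ _ x+y≡N _ = contradiction x+y≡N (endpoint-off-diagonal v-lo)
  ... | tri< lo-below _ _ with <-cmp (x' + y) (N D)
  ...   | tri< below _ _    = inj₂ (inj₁ below)
  ...   | tri≈ _ x'+y≡N _   = contradiction x'+y≡N (endpoint-off-diagonal v-hi)
  ...   | tri> _ _ hi-above = inj₂ (inj₂ (lo-below , hi-above))

  unlocked-lo⇒unmatched : ¬ LockedAt D e lo → x + y < N D → ¬ MatchedAt D e lo
  unlocked-lo⇒unmatched ¬locked below m@(_ , c<x , _) =
    ¬locked ((≤-<-trans z≤n c<x , x<N , s≤s z≤n , y<N) , inj₂ (below , inj₁ refl) , m)

  unlocked-hi⇒unmatched : ¬ LockedAt D e hi → N D < x' + y → ¬ MatchedAt D e hi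
  unlocked-hi⇒unmatched ¬locked above m@(_ , x'<c , _ , _ , _ , k , _ , _ , c≤x₂) =
    ¬locked ((s≤s z≤n , x'<N , s≤s z≤n , y<N) , inj₁ (above , inj₁ refl) , m)
    where
    x'<N : x' < N D
    x'<N = <-≤-trans x'<c (≤-trans c≤x₂ (x₂≤N k))

  law-reading⇔ : IsInteriorEdge D e → LawReadingFlippable D e ⇔ SimpleOrOffDiagonalRotation D e
  law-reading⇔ interior = mk⇔ forward backward
    where
    forward : LawReadingFlippable D e → SimpleOrOffDiagonalRotation D e
    forward (_ , ¬locked-lo , ¬locked-hi) with edge-position
    ... | inj₁ above =
      inj₂ ( rotation-about-lo above
               (unlocked-hi⇒unmatched ¬locked-hi (<-≤-trans above (+-monoˡ-≤ y (<⇒≤ x<x'))))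
           , λ crosses → <⇒≱ above (proj₁ crosses) )
    ... | inj₂ (inj₁ below) =
      inj₂ ( rotation-about-hi below
               (unlocked-lo⇒unmatched ¬locked-lo (≤-<-trans (+-monoˡ-≤ y (<⇒≤ x<x')) below))
           , λ crosses → <⇒≱ below (proj₂ crosses) )
    ... | inj₂ (inj₂ (lo-below , hi-above)) =
      inj₁ (unlocked-lo⇒unmatched ¬locked-lo lo-below , unlocked-hi⇒unmatched ¬locked-hi hi-above)

    backward : SimpleOrOffDiagonalRotation D e → LawReadingFlippable D e
    backward (inj₁ (¬lo , ¬hi)) = interior , ¬lo ∘ locked⇒matched , ¬hi ∘ locked⇒matched
    backward (inj₂ ((lo , _ , ¬hi , _) , ¬meets)) =
      interior
      , (λ locked → ¬hi (matched-hi-below (≰⇒> λ N≤x'+y →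
                      ¬meets (<⇒≤ (locked-lo⇒below locked) , N≤x'+y))))
      , ¬hi ∘ locked⇒matched
    backward (inj₂ ((hi , _ , ¬lo , _) , ¬meets)) =
      interior
      , ¬lo ∘ locked⇒matched
      , (λ locked → ¬lo (matched-lo-above (≰⇒> λ x+y≤N →
                      ¬meets (x+y≤N , <⇒≤ (locked-hi⇒above locked)))))

-- Transposition

transposeRect : Rect → Rect
transposeRect r = mkRect (y₁ r) (y₂ r) (x₁ r) (x₂ r)

-- Reflection in the line x = y maps the main diagonal x + y = N to itself;
-- transposing twice is definitionally the identity (η for records).
transpose : ∀ {n} → Drawing n → Drawing n
transpose D = drawing (N D) (transposeRect ∘ rect D)

transposeEdge : Edge → Edge
transposeEdge (hor y x x') = ver y x x'
transposeEdge (ver x y y') = hor x y y'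

interior-point-swap : ∀ {N a b} → InteriorPoint N a b → InteriorPoint N b a
interior-point-swap (a>0 , a<N , b>0 , b<N) = b>0 , b<N , a>0 , a<N

vertex-transpose : ∀ {n} (D : Drawing n) {a b} → Vertex D a b → Vertex (transpose D) b a
vertex-transpose D (i , ca , cb) = i , cb , ca

module _ {n} (D : Drawing n) where

  edge-transpose : ∀ e → IsEdge D e → IsEdge (transpose D) (transposeEdge e)
  edge-transpose (hor _ _ _) (lt , v , v' , inner , carrier) =
    lt , vertex-transpose D v , vertex-transpose D v' ,
    (λ c l u → inner c l u ∘ vertex-transpose (transpose D)) , carrier
  edge-transpose (ver _ _ _) (lt , v , v' , inner , carrier) =
    lt , vertex-transpose D v , vertex-transpose D v' ,
    (λ c l u → inner c l u ∘ vertex-transpose (transpose D)) , carrier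

  interior-transpose : ∀ e → IsInteriorEdge D e → IsInteriorEdge (transpose D) (transposeEdge e)
  interior-transpose e@(hor _ _ _) (E , bounds) = edge-transpose e E , bounds
  interior-transpose e@(ver _ _ _) (E , bounds) = edge-transpose e E , bounds

  matched-transpose : ∀ e p → MatchedAt D e p → MatchedAt (transpose D) (transposeEdge e) p
  matched-transpose (hor y x x') lo (c , E) = c , edge-transpose (hor y c x) E
  matched-transpose (hor y x x') hi (c , E) = c , edge-transpose (hor y x' c) E
  matched-transpose (ver x y y') lo (c , E) = c , edge-transpose (ver x c y) E
  matched-transpose (ver x y y') hi (c , E) = c , edge-transpose (ver x y' c) E

  towards-transpose : ∀ e p → PointsTowardDiag (N D) e p →
    PointsTowardDiag (N D) (transposeEdge e) p
  towards-transpose (hor y x x') lo (inj₂ (below , _)) =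
    inj₂ (subst (_< N D) (+-comm x y) below , inj₂ refl)
  towards-transpose (hor y x x') hi (inj₁ (above , _)) =
    inj₁ (subst (N D <_) (+-comm x' y) above , inj₂ refl)
  towards-transpose (ver x y y') lo (inj₂ (below , _)) =
    inj₂ (subst (_< N D) (+-comm x y) below , inj₁ refl)
  towards-transpose (ver x y y') hi (inj₁ (above , _)) =
    inj₁ (subst (N D <_) (+-comm x y') above , inj₁ refl)
  towards-transpose (hor _ _ _) lo (inj₁ (_ , inj₁ ()))
  towards-transpose (hor _ _ _) lo (inj₁ (_ , inj₂ ()))
  towards-transpose (hor _ _ _) hi (inj₂ (_ , inj₁ ()))
  towards-transpose (hor _ _ _) hi (inj₂ (_ , inj₂ ()))
  towards-transpose (ver _ _ _) lo (inj₁ (_ , inj₁ ()))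
  towards-transpose (ver _ _ _) lo (inj₁ (_ , inj₂ ()))
  towards-transpose (ver _ _ _) hi (inj₂ (_ , inj₁ ()))
  towards-transpose (ver _ _ _) hi (inj₂ (_ , inj₂ ()))

  endpoint-transpose : ∀ e p → InteriorPoint (N D) (endX e p) (endY e p) →
    InteriorPoint (N D) (endX (transposeEdge e) p) (endY (transposeEdge e) p)
  endpoint-transpose (hor _ _ _) lo = interior-point-swap
  endpoint-transpose (hor _ _ _) hi = interior-point-swap
  endpoint-transpose (ver _ _ _) lo = interior-point-swap
  endpoint-transpose (ver _ _ _) hi = interior-point-swap

  locked-transpose : ∀ e p → LockedAt D e p → LockedAt (transpose D) (transposeEdge e) p
  locked-transpose e p (point , toward , m) =
    endpoint-transpose e p point , towards-transpose e p toward , matched-transpose e p m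

  rectangulation-transpose : IsRectangulation D → IsRectangulation (transpose D)
  rectangulation-transpose (N>0 , within , separated , covered , degree) =
    N>0 ,
    (λ i → let (xi , yi , x≤N , y≤N) = within i in yi , xi , y≤N , x≤N) ,
    (λ i j i≢j → separated-transpose (separated i j i≢j)) ,
    (λ a b a<N b<N →
      let (i , x₁≤ , <x₂ , y₁≤ , <y₂) = covered b a b<N a<N in i , y₁≤ , <y₂ , x₁≤ , <x₂) ,
    (λ a b a>0 a<N b>0 b<N v →
      let (i , side) = degree b a b>0 b<N a>0 a<N (vertex-transpose (transpose D) v)
      in  i , side-transpose side)
    where
    separated-transpose : ∀ {r s} → Separated r s → Separated (transposeRect r) (transposeRect s)
    separated-transpose (inj₁ h)               = inj₂ (inj₂ (inj₁ h))
    separated-transpose (inj₂ (inj₁ h))        = inj₂ (inj₂ (inj₂ h))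
    separated-transpose (inj₂ (inj₂ (inj₁ h))) = inj₁ h
    separated-transpose (inj₂ (inj₂ (inj₂ h))) = inj₂ (inj₁ h)
    side-transpose : ∀ {r a b} → OnSideInterior r b a → OnSideInterior (transposeRect r) a b
    side-transpose (inj₁ h) = inj₂ h
    side-transpose (inj₂ h) = inj₁ h

  diagonal-transpose : DiagonalDrawing D → DiagonalDrawing (transpose D)
  diagonal-transpose (isR , meets , off) =
    rectangulation-transpose isR ,
    (λ i → let (lower , upper) = meets i in
      subst (_≤ N D) (+-comm (x₁ (rect D i)) (y₁ (rect D i))) lower ,
      subst (N D ≤_) (+-comm (x₂ (rect D i)) (y₂ (rect D i))) upper) ,
    (λ a b v → off-transpose (off b a (vertex-transpose (transpose D) v)))
    where
    off-transpose : ∀ {a b} → OffDiag (N D) b a → OffDiag (N D) a b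
    off-transpose {a} {b} (inj₁ b+a≢N) = inj₁ (b+a≢N ∘ trans (+-comm b a))
    off-transpose (inj₂ (inj₁ (b≡0 , a≡N))) = inj₂ (inj₂ (a≡N , b≡0))
    off-transpose (inj₂ (inj₂ (b≡N , a≡0))) = inj₂ (inj₁ (a≡0 , b≡N))

≅-transpose : ∀ {n} {D₁ D₂ : Drawing n} → D₁ ≅ D₂ → transpose D₁ ≅ transpose D₂
≅-transpose (σ , left , below) = σ , below , left

diagonal-rectangulation-transpose : ∀ {n} {D : Drawing n} →
  IsDiagonalRectangulation D → IsDiagonalRectangulation (transpose D)
diagonal-rectangulation-transpose {D = D} (isR , D' , diag , D'≅D) =
  rectangulation-transpose _ isR , transpose D' , diagonal-transpose D' diag ,
  ≅-transpose {D₁ = D'} {D₂ = D} D'≅D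

module _ {n} (D : Drawing n) where

  unmatched-transpose : ∀ e p → ¬ MatchedAt D e p → ¬ MatchedAt (transpose D) (transposeEdge e) p
  unmatched-transpose (hor y x x') p ¬m = ¬m ∘ matched-transpose (transpose D) (ver y x x') p
  unmatched-transpose (ver x y y') p ¬m = ¬m ∘ matched-transpose (transpose D) (hor x y y') p

  unlocked-transpose : ∀ e p → ¬ LockedAt D e p → ¬ LockedAt (transpose D) (transposeEdge e) p
  unlocked-transpose (hor y x x') p ¬l = ¬l ∘ locked-transpose (transpose D) (ver y x x') p
  unlocked-transpose (ver x y y') p ¬l = ¬l ∘ locked-transpose (transpose D) (hor x y y') p

  law-reading-transpose : ∀ e → LawReadingFlippable D e →
    LawReadingFlippable (transpose D) (transposeEdge e)
  law-reading-transpose e (interior , ¬lo , ¬hi) =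
    interior-transpose D e interior , unlocked-transpose e lo ¬lo , unlocked-transpose e hi ¬hi

  transpose-results : ∀ {A B : Set} {r r' s s'} → A × B × r ≡ r' × s ≡ s' →
    A × B × transposeRect r ≡ transposeRect r' × transposeRect s ≡ transposeRect s'
  transpose-results (a , b , r≡ , s≡) = a , b , cong transposeRect r≡ , cong transposeRect s≡

  rotated-transpose : ∀ {D'} e p → RotatedAbout D e p D' →
    RotatedAbout (transpose D) (transposeEdge e) p (transpose D')
  rotated-transpose {D'} e p (N≡ , i , j , i≢j , separates , step , elsewhere) =
    N≡ , i , j , i≢j , separates-transpose e separates , step-transpose e p step ,
    λ k k≢i k≢j → cong transposeRect (elsewhere k k≢i k≢j)
    where
    separates-transpose : ∀ e → Separates D e i j → Separates (transpose D) (transposeEdge e) i j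
    separates-transpose (hor _ _ _) s = s
    separates-transpose (ver _ _ _) s = s
    step-transpose : ∀ e p → RotStep D e p i j (rect D' i) (rect D' j) →
      RotStep (transpose D) (transposeEdge e) p i j (rect (transpose D') i) (rect (transpose D') j)
    step-transpose (hor _ _ _) lo = transpose-results
    step-transpose (hor _ _ _) hi = transpose-results
    step-transpose (ver _ _ _) lo = transpose-results
    step-transpose (ver _ _ _) hi = transpose-results

  flip-transpose : ∀ e → SimpleOrOffDiagonalRotation D e →
    SimpleOrOffDiagonalRotation (transpose D) (transposeEdge e)
  flip-transpose e (inj₁ (¬lo , ¬hi)) =
    inj₁ (unmatched-transpose e lo ¬lo , unmatched-transpose e hi ¬hi)
  flip-transpose e (inj₂ ((p , m , ¬m , D' , rotated , D'-diagonal) , ¬meets)) =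
    inj₂ ( ( p , matched-transpose D e p m , unmatched-transpose e (opp p) ¬m , transpose D'
           , rotated-transpose e p rotated , diagonal-rectangulation-transpose D'-diagonal )
         , ¬meets ∘ intersects-transposed e )
    where
    intersects-transposed : ∀ e → IntersectsDiag (N D) (transposeEdge e) → IntersectsDiag (N D) e
    intersects-transposed (hor y x x') (lower , upper) =
      subst (_≤ N D) (+-comm y x) lower , subst (N D ≤_) (+-comm y x') upper
    intersects-transposed (ver x y y') (lower , upper) =
      subst (_≤ N D) (+-comm y x) lower , subst (N D ≤_) (+-comm y' x) upper

horizontal-law-reading⇔ : ∀ {n} (D : Drawing n) → DiagonalDrawing D → ∀ {y x x'} →
  IsInteriorEdge D (hor y x x') →
  LawReadingFlippable D (hor y x x') ⇔ SimpleOrOffDiagonalRotation D (hor y x x')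
horizontal-law-reading⇔ D diag
  interior@((s≤s x≤x'₀ , v-lo , v-hi , inner , K , side , left , right) , s≤s z≤n , y<N) =
  HorizontalEdge.law-reading⇔ diag x≤x'₀ v-lo v-hi inner K side left right y<N interior

lemma5 : ∀ {n : ℕ} (R : Drawing n) → DiagonalDrawing R →
    (e : Edge) → IsInteriorEdge R e →
    LawReadingFlippable R e
      ⇔ (SimplyFlippable R e
         ⊎ (FlippableByRotation R e × ¬ IntersectsDiag (N R) e))
lemma5 R diag (hor y x x') interior = horizontal-law-reading⇔ R diag interior
lemma5 R diag (ver x y y') interior = mk⇔
  (flip-transpose (transpose R) (hor x y y') ∘ to ∘ law-reading-transpose R (ver x y y'))
  (law-reading-transpose (transpose R) (hor x y y') ∘ from ∘ flip-transpose R (ver x y y'))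
  where
  open Equivalence (horizontal-law-reading⇔ (transpose R) (diagonal-transpose R diag)
                                            (interior-transpose R (ver x y y') interior))
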